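{- Let $m$ and $r$ be positive integers. Then \[ \biggl(\sum_{k=0}^{m-1} \left(\mathbf{h}_{kr} - \mathbf{h}_{kr+1}\right)\biggr)^{ -1} = \sum_{L}\mathbf{r}_L, \] where the sum on the right is over all compositions $L$ in which every part is congruent to $0, 1, \dots,$ or $r-1$ modulo $mr$.
   Context: Let $X_1,X_2,\dots$ be noncommuting variables, and work in the ring of formal power series in these variables with integer coefficients. For $n\ge 0$ the complete noncommutative symmetric function is $\mathbf{h}_n=\sum_{i_1\le i_2\le\cdots\le i_n} X_{i_1}X_{i_2}\cdots X_{i_n}$ (so $\mathbf{h}_0=1$). A composition is a finite (possibly empty) sequence of positive integers; a composition of $n$ is one with sum $n$. For a composition $L=(L_1,\dots,L_k)$ of $n$, the ribbon noncommutative symmetric function is $\mathbf{r}_L=\sum X_{i_1}X_{i_2}\cdots X_{i_n}$, summed over all $i_1,\dots,i_n$ with $i_1\le\cdots\le i_{L_1} > i_{L_1+1}\le\cdots\le i_{L_1+L_2} > \cdots > i_{L_1+\cdots+L_{k-1}+1}\le\cdots\le i_n$; i.e., the sum of all words whose maximal weakly increasing runs have lengths $L_1,\dots,L_k$ in order (and $\mathbf{r}_{\emptyset}=1$). -}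

module Defs where

open import Data.Nat as ℕ using (ℕ; zero; suc; NonZero; _%_; _<ᵇ_; _≡ᵇ_)
open import Data.Nat.Properties using (m*n≢0)
open import Data.Integer as ℤ using (ℤ; 0ℤ; 1ℤ)
open import Data.List using (List; []; _∷_; [_]; map; foldr; length; take; drop; concatMap; filterᵇ)
open import Data.Bool using (Bool; true; false; _∧_; if_then_else_)
open import Data.Product using (_×_; _,_)
open import Relation.Binary.PropositionalEquality using (_≡_)

-- Letters: the natural number i stands for the variable X_{i+1}
-- (order-preserving relabelling of the positive indices).
Word : Set
Word = List ℕ

-- A formal power series in noncommuting variables with ℤ coefficients:
-- its coefficient function on words.
Series : Set
Series = Word → ℤ

sumℤ : List ℤ → ℤ
sumℤ = foldr ℤ._+_ 0ℤ

zeroS : Series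
zeroS _ = 0ℤ

oneS : Series
oneS [] = 1ℤ
oneS (_ ∷ _) = 0ℤ

_⊕_ : Series → Series → Series
(f ⊕ g) w = f w ℤ.+ g w

_⊖_ : Series → Series → Series
(f ⊖ g) w = f w ℤ.- g w

splits : Word → List (Word × Word)
splits [] = [ ([] , []) ]
splits (a ∷ w) = ([] , a ∷ w) ∷ map (λ { (u , v) → (a ∷ u , v) }) (splits w)

_⊛_ : Series → Series → Series
(f ⊛ g) w = sumℤ (map (λ { (u , v) → f u ℤ.* g v }) (splits w))

ΣS : ℕ → (ℕ → Series) → Series
ΣS zero F = zeroS
ΣS (suc m) F = ΣS m F ⊕ F m

IsInverse : Series → Series → Set
IsInverse f g = (∀ w → (f ⊛ g) w ≡ oneS w) × (∀ w → (g ⊛ f) w ≡ oneS w)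

weakInc : Word → Bool
weakInc [] = true
weakInc (a ∷ []) = true
weakInc (a ∷ b ∷ w) = (a ℕ.≤ᵇ b) ∧ weakInc (b ∷ w)

indicator : Bool → ℤ
indicator b = if b then 1ℤ else 0ℤ

h : ℕ → Series
h n w = indicator ((length w ≡ᵇ n) ∧ weakInc w)

lastW : Word → ℕ → ℕ
lastW [] d = d
lastW (a ∷ []) d = a
lastW (a ∷ b ∷ w) d = lastW (b ∷ w) d

descentBetween : Word → Word → Bool
descentBetween u [] = true
descentBetween [] (b ∷ v) = true
descentBetween (a ∷ u) (b ∷ v) = b <ᵇ lastW (a ∷ u) a

-- w satisfies the ribbon pattern of L: it is a concatenation of blocks of
-- lengths L₁,…,L_k, each weakly increasing, with a strict descent between
-- consecutive blocks.
ribbonOK : List ℕ → Word → Bool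
ribbonOK [] w = length w ≡ᵇ 0
ribbonOK (l ∷ []) w = (length w ≡ᵇ l) ∧ weakInc w
ribbonOK (l ∷ l' ∷ L) w =
  (length (take l w) ≡ᵇ l) ∧ weakInc (take l w)
    ∧ descentBetween (take l w) (drop l w) ∧ ribbonOK (l' ∷ L) (drop l w)

ribbon : List ℕ → Series
ribbon L w = indicator (ribbonOK L w)

-- all compositions of n (sequences of positive integers summing to n),
-- each listed exactly once
compositions : ℕ → List (List ℕ)
compositions zero = [ [] ]
compositions (suc n) = concatMap step (compositions n)
  where
  step : List ℕ → List (List ℕ)
  step [] = [ 1 ∷ [] ]
  step (a ∷ L) = (1 ∷ a ∷ L) ∷ (suc a ∷ L) ∷ []

goodPart : (m r : ℕ) → .{{NonZero m}} → .{{NonZero r}} → ℕ → Bool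
goodPart m r p = (p % (m ℕ.* r)) {{m*n≢0 m r}} <ᵇ r

goodComp : (m r : ℕ) → .{{NonZero m}} → .{{NonZero r}} → List ℕ → Bool
goodComp m r [] = true
goodComp m r (p ∷ L) = goodPart m r p ∧ goodComp m r L

LHSseries : ℕ → ℕ → Series
LHSseries m r = ΣS m (λ k → h (k ℕ.* r) ⊖ h (suc (k ℕ.* r)))

-- Only compositions of |w| contribute to the coefficient of w, so the
-- coefficient is the finite sum over compositions of length w.
RHSseries : (m r : ℕ) → .{{NonZero m}} → .{{NonZero r}} → Series
RHSseries m r w =
  sumℤ (map (λ L → ribbon L w) (filterᵇ (goodComp m r) (compositions (length w))))

-- Every word has exactly one ribbon shape, namely the sequence of lengths of its
-- maximal weakly increasing runs, so the right-hand side is the series whose coefficient of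
-- a word is Π_runs γ(run length), with γ q = [q mod mr < r] (RibbonSum).  The left-hand side
-- is Σ_n c_n h_n with c_n = #{k < m : n = kr} − #{k < m : n = kr+1}.  In a product of
-- Σ_n c_n h_n with such a run series, a factorisation u ++ v of a word with u weakly
-- increasing cuts the first run, so the product is governed by the convolution of the integer
-- sequences c and γ alone (InversionPrinciple): if c ⋆ γ = δ₀ the two series are inverse.
-- Finally c ⋆ γ = δ₀ reduces to E p = Σ_{k<m, kr ≤ p} γ(p − kr) = 1 for all p, which holds
-- because E is r-periodic and equals 1 below r (Arithmetic).

module Submission where

open import Defs
open import Data.Nat as ℕ using (ℕ; zero; suc; NonZero; _<_; _≤_; _∸_; _<ᵇ_; _≤ᵇ_; _≡ᵇ_; _%_; _/_; z≤n; s≤s)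
open import Data.Nat.DivMod using (m≡m%n+[m/n]*n; m%n<n; [m+n]%n≡m%n; m<n⇒m%n≡m)
import Data.Nat.Properties as ℕP
open import Data.Integer using (ℤ; 0ℤ; 1ℤ; _+_; _*_; _-_)
import Data.Integer.Properties as ℤP
open import Data.Integer.Tactic.RingSolver using (solve-∀)
open import Data.List using (List; []; _∷_; map; downFrom; length; take; drop; concatMap; filterᵇ; _++_)
open import Data.List.Properties using (map-∘; map-cong)
open import Data.Bool using (Bool; true; false; not; _∧_; if_then_else_)
import Data.Bool.Properties as BoolP
open import Data.Bool.ListAction using (all)
open import Data.Product using (_×_; _,_)
open import Relation.Nullary using (yes; no)
open import Relation.Binary.PropositionalEquality

ι : Bool → ℤ
ι = indicator

ι-∧ : ∀ a b → ι (a ∧ b) ≡ ι a * ι b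
ι-∧ true b = sym (ℤP.*-identityˡ (ι b))
ι-∧ false b = refl

sumOver : {A : Set} → (A → ℤ) → List A → ℤ
sumOver f xs = sumℤ (map f xs)

module _ {A : Set} where

  sumOver-cong : ∀ {f g : A → ℤ} → f ≗ g → ∀ xs → sumOver f xs ≡ sumOver g xs
  sumOver-cong f≗g xs = cong sumℤ (map-cong f≗g xs)

  sumOver-+ : ∀ (f g : A → ℤ) xs → sumOver (λ x → f x + g x) xs ≡ sumOver f xs + sumOver g xs
  sumOver-+ f g [] = refl
  sumOver-+ f g (x ∷ xs) =
    trans (cong (f x + g x +_) (sumOver-+ f g xs)) (interchange (f x) (g x) (sumOver f xs) (sumOver g xs))
    where
    interchange : ∀ a b c d → (a + b) + (c + d) ≡ (a + c) + (b + d)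
    interchange = solve-∀

  sumOver-- : ∀ (f g : A → ℤ) xs → sumOver (λ x → f x - g x) xs ≡ sumOver f xs - sumOver g xs
  sumOver-- f g [] = refl
  sumOver-- f g (x ∷ xs) =
    trans (cong (f x - g x +_) (sumOver-- f g xs)) (interchange (f x) (g x) (sumOver f xs) (sumOver g xs))
    where
    interchange : ∀ a b c d → (a - b) + (c - d) ≡ (a + c) - (b + d)
    interchange = solve-∀

  sumOver-scale : ∀ k (f : A → ℤ) xs → sumOver (λ x → k * f x) xs ≡ k * sumOver f xs
  sumOver-scale k f [] = sym (ℤP.*-zeroʳ k)
  sumOver-scale k f (x ∷ xs) =
    trans (cong (k * f x +_) (sumOver-scale k f xs)) (sym (ℤP.*-distribˡ-+ k (f x) _))

  sumOver-zero : ∀ (xs : List A) → sumOver (λ _ → 0ℤ) xs ≡ 0ℤ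
  sumOver-zero [] = refl
  sumOver-zero (x ∷ xs) = trans (ℤP.+-identityˡ _) (sumOver-zero xs)

  sumOver-++ : ∀ (f : A → ℤ) xs ys → sumOver f (xs ++ ys) ≡ sumOver f xs + sumOver f ys
  sumOver-++ f [] ys = sym (ℤP.+-identityˡ _)
  sumOver-++ f (x ∷ xs) ys = trans (cong (f x +_) (sumOver-++ f xs ys)) (sym (ℤP.+-assoc (f x) _ _))

  sumOver-filter : ∀ (p : A → Bool) (f : A → ℤ) xs →
    sumOver f (filterᵇ p xs) ≡ sumOver (λ x → ι (p x) * f x) xs
  sumOver-filter p f [] = refl
  sumOver-filter p f (x ∷ xs) with p x
  ... | true = cong₂ _+_ (sym (ℤP.*-identityˡ (f x))) (sumOver-filter p f xs)
  ... | false = trans (sumOver-filter p f xs) (sym (ℤP.+-identityˡ _))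

  sumOver-scaleʳ : ∀ k (f : A → ℤ) xs → sumOver (λ x → f x * k) xs ≡ sumOver f xs * k
  sumOver-scaleʳ k f xs = begin
    sumOver (λ x → f x * k) xs ≡⟨ sumOver-cong (λ x → ℤP.*-comm (f x) k) xs ⟩
    sumOver (λ x → k * f x) xs ≡⟨ sumOver-scale k f xs ⟩
    k * sumOver f xs           ≡⟨ ℤP.*-comm k _ ⟩
    sumOver f xs * k           ∎
    where open ≡-Reasoning

sumOver-concatMap : {A B : Set} (f : A → ℤ) (g : B → List A) (xs : List B) →
  sumOver f (concatMap g xs) ≡ sumOver (λ x → sumOver f (g x)) xs
sumOver-concatMap f g [] = refl
sumOver-concatMap f g (x ∷ xs) =
  trans (sumOver-++ f (g x) (concatMap g xs)) (cong (sumOver f (g x) +_) (sumOver-concatMap f g xs))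

sumOver-swap : {A B : Set} (f : A → B → ℤ) (xs : List A) (ys : List B) →
  sumOver (λ x → sumOver (f x) ys) xs ≡ sumOver (λ y → sumOver (λ x → f x y) xs) ys
sumOver-swap f [] ys = sym (sumOver-zero ys)
sumOver-swap f (x ∷ xs) ys =
  trans (cong (sumOver (f x) ys +_) (sumOver-swap f xs ys)) (sym (sumOver-+ (f x) _ ys))

-- sumBelow n f = Σ_{i<n} f i, summed from the top: sumBelow (suc n) f = f n + sumBelow n f.
sumBelow : ℕ → (ℕ → ℤ) → ℤ
sumBelow n f = sumOver f (downFrom n)

sumBelow-cong : ∀ n {f g : ℕ → ℤ} → (∀ i → i < n → f i ≡ g i) → sumBelow n f ≡ sumBelow n g
sumBelow-cong zero f≡g = refl
sumBelow-cong (suc n) f≡g =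
  cong₂ _+_ (f≡g n ℕP.≤-refl) (sumBelow-cong n (λ i i<n → f≡g i (ℕP.m<n⇒m<1+n i<n)))

sumBelow-first : ∀ n f → sumBelow (suc n) f ≡ f 0 + sumBelow n (λ i → f (suc i))
sumBelow-first zero f = refl
sumBelow-first (suc n) f = begin
  f (suc n) + sumBelow (suc n) f                      ≡⟨ cong (f (suc n) +_) (sumBelow-first n f) ⟩
  f (suc n) + (f 0 + sumBelow n (λ i → f (suc i)))    ≡⟨ swap (f (suc n)) (f 0) _ ⟩
  f 0 + (f (suc n) + sumBelow n (λ i → f (suc i)))    ∎
  where
  open ≡-Reasoning
  swap : ∀ a b c → a + (b + c) ≡ b + (a + c)
  swap = solve-∀

delta-step : ∀ n j (g : ℕ → ℤ) → ι (n ≡ᵇ j) * g n + ι (j <ᵇ n) * g j ≡ ι (j <ᵇ suc n) * g j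
delta-step zero zero g = ℤP.+-identityʳ _
delta-step zero (suc j) g = refl
delta-step (suc n) zero g = ℤP.+-identityˡ _
delta-step (suc n) (suc j) g = delta-step n j (λ i → g (suc i))

sumBelow-delta : ∀ n j (g : ℕ → ℤ) → sumBelow n (λ i → ι (i ≡ᵇ j) * g i) ≡ ι (j <ᵇ n) * g j
sumBelow-delta zero j g = refl
sumBelow-delta (suc n) j g = trans (cong (ι (n ≡ᵇ j) * g n +_) (sumBelow-delta n j g)) (delta-step n j g)

ΣS-coeff : ∀ n F u → ΣS n F u ≡ sumBelow n (λ k → F k u)
ΣS-coeff zero F u = refl
ΣS-coeff (suc n) F u = trans (cong (_+ F n u) (ΣS-coeff n F u)) (ℤP.+-comm _ (F n u))

<ᵇ-true : ∀ {m n} → m < n → (m <ᵇ n) ≡ true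
<ᵇ-true {zero} (s≤s _) = refl
<ᵇ-true {suc m} (s≤s m<n) = <ᵇ-true m<n

<ᵇ-false : ∀ {m n} → n ≤ m → (m <ᵇ n) ≡ false
<ᵇ-false z≤n = refl
<ᵇ-false (s≤s n≤m) = <ᵇ-false n≤m

<ᵇ-cancelˡ : ∀ k a b → (k ℕ.+ a <ᵇ k ℕ.+ b) ≡ (a <ᵇ b)
<ᵇ-cancelˡ zero a b = refl
<ᵇ-cancelˡ (suc k) a b = <ᵇ-cancelˡ k a b

if-as-sum : ∀ t (x y : ℤ) → (if t then x else y) ≡ ι t * x + ι (not t) * y
if-as-sum true x y = sum1 x y
  where
  sum1 : ∀ x y → x ≡ 1ℤ * x + 0ℤ * y
  sum1 = solve-∀
if-as-sum false x y = sum2 x y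
  where
  sum2 : ∀ x y → y ≡ 0ℤ * x + 1ℤ * y
  sum2 = solve-∀

<ᵇ-suc : ∀ m n → (m <ᵇ suc n) ≡ (m ≤ᵇ n)
<ᵇ-suc zero n = refl
<ᵇ-suc (suc m) n = refl

<ᵇ-flip : ∀ m n → (n <ᵇ m) ≡ not (m ≤ᵇ n)
<ᵇ-flip zero n = refl
<ᵇ-flip (suc m) zero = refl
<ᵇ-flip (suc m) (suc n) = trans (<ᵇ-flip m n) (cong not (sym (<ᵇ-suc m n)))

_·_ : ℤ → Series → Series
(k · f) w = k * f w

∂ : ℕ → Series → Series
∂ a f u = f (a ∷ u)

-- The Cauchy product is computed letter by letter: on the empty word it is the
-- product of constant terms, and on a ∷ w only the empty prefix does not start with a.
⊛-nil : ∀ f g → (f ⊛ g) [] ≡ f [] * g []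
⊛-nil f g = ℤP.+-identityʳ _

⊛-cons : ∀ f g a w → (f ⊛ g) (a ∷ w) ≡ f [] * g (a ∷ w) + (∂ a f ⊛ g) w
⊛-cons f g a w = cong (f [] * g (a ∷ w) +_) (cong sumℤ (sym (map-∘ (splits w))))

⊛-congˡ : ∀ {f f'} g → f ≗ f' → (f ⊛ g) ≗ (f' ⊛ g)
⊛-congˡ g f≗f' w = sumOver-cong (λ { (u , v) → cong (_* g v) (f≗f' u) }) (splits w)

⊛-congʳ : ∀ f {g g'} → g ≗ g' → (f ⊛ g) ≗ (f ⊛ g')
⊛-congʳ f g≗g' w = sumOver-cong (λ { (u , v) → cong (f u *_) (g≗g' v) }) (splits w)

⊛-distribʳ-⊕ : ∀ f f' g → ((f ⊕ f') ⊛ g) ≗ ((f ⊛ g) ⊕ (f' ⊛ g))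
⊛-distribʳ-⊕ f f' g w =
  trans (sumOver-cong (λ { (u , v) → ℤP.*-distribʳ-+ (g v) (f u) (f' u) }) (splits w))
        (sumOver-+ _ _ (splits w))

⊛-distribˡ-⊖ : ∀ f g g' → (f ⊛ (g ⊖ g')) ≗ ((f ⊛ g) ⊖ (f ⊛ g'))
⊛-distribˡ-⊖ f g g' w =
  trans (sumOver-cong (λ { (u , v) → distrib (f u) (g v) (g' v) }) (splits w))
        (sumOver-- _ _ (splits w))
  where
  distrib : ∀ a b c → a * (b - c) ≡ a * b - a * c
  distrib = solve-∀

⊛-scaleˡ : ∀ k f g → ((k · f) ⊛ g) ≗ (k · (f ⊛ g))
⊛-scaleˡ k f g w =
  trans (sumOver-cong (λ { (u , v) → ℤP.*-assoc k (f u) (g v) }) (splits w))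
        (sumOver-scale k _ (splits w))

⊛-zeroˡ : ∀ g → (zeroS ⊛ g) ≗ zeroS
⊛-zeroˡ g [] = refl
⊛-zeroˡ g (a ∷ w) = trans (⊛-cons zeroS g a w) (trans (ℤP.+-identityˡ _) (⊛-zeroˡ g w))

⊛-identityˡ : ∀ f → (oneS ⊛ f) ≗ f
⊛-identityˡ f [] = trans (⊛-nil oneS f) (ℤP.*-identityˡ (f []))
⊛-identityˡ f (a ∷ w) = begin
  (oneS ⊛ f) (a ∷ w)               ≡⟨ ⊛-cons oneS f a w ⟩
  1ℤ * f (a ∷ w) + (zeroS ⊛ f) w   ≡⟨ cong₂ _+_ (ℤP.*-identityˡ (f (a ∷ w))) (⊛-zeroˡ f w) ⟩
  f (a ∷ w) + 0ℤ                   ≡⟨ ℤP.+-identityʳ (f (a ∷ w)) ⟩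
  f (a ∷ w)                        ∎
  where open ≡-Reasoning

⊛-identityʳ : ∀ f → (f ⊛ oneS) ≗ f
⊛-identityʳ f [] = trans (⊛-nil f oneS) (ℤP.*-identityʳ (f []))
⊛-identityʳ f (a ∷ w) = begin
  (f ⊛ oneS) (a ∷ w)                 ≡⟨ ⊛-cons f oneS a w ⟩
  f [] * 0ℤ + (∂ a f ⊛ oneS) w       ≡⟨ cong₂ _+_ (ℤP.*-zeroʳ (f [])) (⊛-identityʳ (∂ a f) w) ⟩
  0ℤ + f (a ∷ w)                     ≡⟨ ℤP.+-identityˡ (f (a ∷ w)) ⟩
  f (a ∷ w)                          ∎
  where open ≡-Reasoning

-- Associativity, by induction on the word: the left derivative of a product is
-- ∂ a (f ⊛ g) = f [] · ∂ a g ⊕ ∂ a f ⊛ g (this is ⊛-cons read pointwise).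
⊛-assoc : ∀ f g h → ((f ⊛ g) ⊛ h) ≗ (f ⊛ (g ⊛ h))
⊛-assoc f g h [] = begin
  (f [] * g [] + 0ℤ) * h [] + 0ℤ   ≡⟨ cong (λ x → x * h [] + 0ℤ) (⊛-nil f g) ⟩
  f [] * g [] * h [] + 0ℤ          ≡⟨ cong (_+ 0ℤ) (ℤP.*-assoc (f []) (g []) (h [])) ⟩
  f [] * (g [] * h []) + 0ℤ        ≡⟨ cong (λ x → f [] * x + 0ℤ) (⊛-nil g h) ⟨
  (f ⊛ (g ⊛ h)) []                 ∎
  where open ≡-Reasoning
⊛-assoc f g h (a ∷ w) = begin
  ((f ⊛ g) ⊛ h) (a ∷ w)
    ≡⟨ ⊛-cons (f ⊛ g) h a w ⟩
  (f ⊛ g) [] * h (a ∷ w) + (∂ a (f ⊛ g) ⊛ h) w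
    ≡⟨ cong₂ (λ x y → x * h (a ∷ w) + y) (⊛-nil f g) (⊛-congˡ h (⊛-cons f g a) w) ⟩
  f [] * g [] * h (a ∷ w) + (((f [] · ∂ a g) ⊕ (∂ a f ⊛ g)) ⊛ h) w
    ≡⟨ cong (f [] * g [] * h (a ∷ w) +_) (⊛-distribʳ-⊕ (f [] · ∂ a g) (∂ a f ⊛ g) h w) ⟩
  f [] * g [] * h (a ∷ w) + (((f [] · ∂ a g) ⊛ h) w + ((∂ a f ⊛ g) ⊛ h) w)
    ≡⟨ cong₂ (λ x y → f [] * g [] * h (a ∷ w) + (x + y))
             (⊛-scaleˡ (f []) (∂ a g) h w) (⊛-assoc (∂ a f) g h w) ⟩
  f [] * g [] * h (a ∷ w) + (f [] * (∂ a g ⊛ h) w + (∂ a f ⊛ (g ⊛ h)) w)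
    ≡⟨ regroup (f []) (g []) (h (a ∷ w)) ((∂ a g ⊛ h) w) ((∂ a f ⊛ (g ⊛ h)) w) ⟩
  f [] * (g [] * h (a ∷ w) + (∂ a g ⊛ h) w) + (∂ a f ⊛ (g ⊛ h)) w
    ≡⟨ cong (λ x → f [] * x + (∂ a f ⊛ (g ⊛ h)) w) (⊛-cons g h a w) ⟨
  f [] * (g ⊛ h) (a ∷ w) + (∂ a f ⊛ (g ⊛ h)) w
    ≡⟨ ⊛-cons f (g ⊛ h) a w ⟨
  (f ⊛ (g ⊛ h)) (a ∷ w) ∎
  where
  open ≡-Reasoning
  regroup : ∀ x y z u v → x * y * z + (x * u + v) ≡ x * (y * z + u) + v
  regroup = solve-∀

VanishesOnSuffixes : Series → Word → Set
VanishesOnSuffixes e [] = e [] ≡ 0ℤ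
VanishesOnSuffixes e (a ∷ w) = e (a ∷ w) ≡ 0ℤ × VanishesOnSuffixes e w

-- Every term of (g ⊛ e) w pairs a prefix with a suffix of w, so it vanishes.
⊛-vanishes : ∀ g e w → VanishesOnSuffixes e w → (g ⊛ e) w ≡ 0ℤ
⊛-vanishes g e [] e[]≡0 = trans (⊛-nil g e) (trans (cong (g [] *_) e[]≡0) (ℤP.*-zeroʳ (g [])))
⊛-vanishes g e (a ∷ w) (eaw≡0 , rest) = begin
  (g ⊛ e) (a ∷ w)                  ≡⟨ ⊛-cons g e a w ⟩
  g [] * e (a ∷ w) + (∂ a g ⊛ e) w ≡⟨ cong₂ _+_ (cong (g [] *_) eaw≡0) (⊛-vanishes (∂ a g) e w rest) ⟩
  g [] * 0ℤ + 0ℤ                   ≡⟨ ℤP.+-identityʳ (g [] * 0ℤ) ⟩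
  g [] * 0ℤ                        ≡⟨ ℤP.*-zeroʳ (g []) ⟩
  0ℤ                               ∎
  where open ≡-Reasoning

-- A series with constant term 1 is not a left zero divisor: if f ⊛ e = 0 then e = 0,
-- by induction on the word, since (f ⊛ e)(a ∷ w) = e (a ∷ w) + (terms on shorter suffixes).
⊛-cancelˡ : ∀ f e → f [] ≡ 1ℤ → (f ⊛ e) ≗ zeroS → ∀ w → VanishesOnSuffixes e w
⊛-cancelˡ f e f[]≡1 fe≡0 [] =
  trans (sym (trans (⊛-nil f e) (trans (cong (_* e []) f[]≡1) (ℤP.*-identityˡ (e []))))) (fe≡0 [])
⊛-cancelˡ f e f[]≡1 fe≡0 (a ∷ w) = trans (sym leading) (fe≡0 (a ∷ w)) , rest
  where
  open ≡-Reasoning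
  rest : VanishesOnSuffixes e w
  rest = ⊛-cancelˡ f e f[]≡1 fe≡0 w
  leading : (f ⊛ e) (a ∷ w) ≡ e (a ∷ w)
  leading = begin
    (f ⊛ e) (a ∷ w)                  ≡⟨ ⊛-cons f e a w ⟩
    f [] * e (a ∷ w) + (∂ a f ⊛ e) w ≡⟨ cong₂ _+_ (cong (_* e (a ∷ w)) f[]≡1) (⊛-vanishes (∂ a f) e w rest) ⟩
    1ℤ * e (a ∷ w) + 0ℤ              ≡⟨ ℤP.+-identityʳ _ ⟩
    1ℤ * e (a ∷ w)                   ≡⟨ ℤP.*-identityˡ _ ⟩
    e (a ∷ w)                        ∎

vanishesAt : ∀ e w → VanishesOnSuffixes e w → e w ≡ 0ℤ
vanishesAt e [] e[]≡0 = e[]≡0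
vanishesAt e (a ∷ w) (eaw≡0 , _) = eaw≡0

-- In the series ring a right inverse of a series with constant term 1 is two-sided:
-- e = g ⊛ f - 1 satisfies f ⊛ e = (f ⊛ g) ⊛ f - f = 0, hence e = 0.
rightInverse⇒inverse : ∀ f g → f [] ≡ 1ℤ → (f ⊛ g) ≗ oneS → IsInverse f g
rightInverse⇒inverse f g f[]≡1 fg≡1 = fg≡1 , gf≡1
  where
  open ≡-Reasoning
  e : Series
  e = (g ⊛ f) ⊖ oneS
  fe≡0 : (f ⊛ e) ≗ zeroS
  fe≡0 w = begin
    (f ⊛ e) w                        ≡⟨ ⊛-distribˡ-⊖ f (g ⊛ f) oneS w ⟩
    (f ⊛ (g ⊛ f)) w - (f ⊛ oneS) w   ≡⟨ cong₂ _-_ (sym (⊛-assoc f g f w)) (⊛-identityʳ f w) ⟩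
    ((f ⊛ g) ⊛ f) w - f w            ≡⟨ cong (_- f w) (trans (⊛-congˡ f fg≡1 w) (⊛-identityˡ f w)) ⟩
    f w - f w                        ≡⟨ ℤP.+-inverseʳ (f w) ⟩
    0ℤ                               ∎
  gf≡1 : (g ⊛ f) ≗ oneS
  gf≡1 w = ℤP.i-j≡0⇒i≡j _ _ (vanishesAt e w (⊛-cancelˡ f e f[]≡1 fe≡0 w))

IsInverse-cong : ∀ {f f' g g'} → f ≗ f' → g ≗ g' → IsInverse f' g' → IsInverse f g
IsInverse-cong {f} {f'} {g} {g'} f≗f' g≗g' (f'g'≡1 , g'f'≡1) =
  (λ w → trans (⊛-congˡ g f≗f' w) (trans (⊛-congʳ f' g≗g' w) (f'g'≡1 w))) ,
  (λ w → trans (⊛-congˡ f g≗g' w) (trans (⊛-congʳ g' f≗f' w) (g'f'≡1 w)))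

-- For weights γ on run lengths, runWeight γ q x w is the product of γ over
-- the lengths of the maximal weakly increasing runs of v ++ w, for any weakly increasing
-- word v of length q ending in the letter x (only q and x matter).
runWeight : (ℕ → ℤ) → ℕ → ℕ → Word → ℤ
runWeight γ q x [] = γ q
runWeight γ q x (b ∷ w) = if x ≤ᵇ b then runWeight γ (suc q) b w else γ q * runWeight γ 1 b w

runSeries : (ℕ → ℤ) → Series
runSeries γ [] = 1ℤ
runSeries γ (b ∷ w) = runWeight γ 1 b w

runWeight-asc : ∀ γ q x b w → (x ≤ᵇ b) ≡ true → runWeight γ q x (b ∷ w) ≡ runWeight γ (suc q) b w
runWeight-asc γ q x b w x≤b = cong (λ t → if t then _ else _) x≤b

runWeight-desc : ∀ γ q x b w → (x ≤ᵇ b) ≡ false → runWeight γ q x (b ∷ w) ≡ γ q * runWeight γ 1 b w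
runWeight-desc γ q x b w x≰b = cong (λ t → if t then _ else _) x≰b

runWeight-cons : ∀ γ q b c w → runWeight γ q b (c ∷ w)
  ≡ ι (c <ᵇ b) * γ q * runWeight γ 1 c w + ι (b ≤ᵇ c) * runWeight γ (suc q) c w
runWeight-cons γ q b c w = begin
  runWeight γ q b (c ∷ w)
    ≡⟨ if-as-sum (b ≤ᵇ c) (runWeight γ (suc q) c w) (γ q * R) ⟩
  ι (b ≤ᵇ c) * runWeight γ (suc q) c w + ι (not (b ≤ᵇ c)) * (γ q * R)
    ≡⟨ cong (λ t → ι (b ≤ᵇ c) * runWeight γ (suc q) c w + ι t * (γ q * R)) (<ᵇ-flip b c) ⟨
  ι (b ≤ᵇ c) * runWeight γ (suc q) c w + ι (c <ᵇ b) * (γ q * R)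
    ≡⟨ reorder (ι (b ≤ᵇ c)) (runWeight γ (suc q) c w) (ι (c <ᵇ b)) (γ q) R ⟩
  ι (c <ᵇ b) * γ q * R + ι (b ≤ᵇ c) * runWeight γ (suc q) c w ∎
  where
  open ≡-Reasoning
  R : ℤ
  R = runWeight γ 1 c w
  reorder : ∀ a x d g y → a * x + d * (g * y) ≡ d * g * y + a * x
  reorder = solve-∀

-- The series Σ_n c_n h_n: its coefficient of w is c_{|w|} if w is weakly increasing.
incSeries : (ℕ → ℤ) → Series
incSeries c w = ι (weakInc w) * c (length w)

conv : (ℕ → ℤ) → (ℕ → ℤ) → ℕ → ℤ
conv c γ p = sumBelow (suc p) (λ i → c i * γ (p ∸ i))

δ₀ : ℕ → ℤ
δ₀ zero = 1ℤ
δ₀ (suc _) = 0ℤ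

-- A factorisation
-- u ++ v of a word with u weakly increasing cuts the word inside its first run, so the
-- coefficient of the product only sees the first-run length, where c ⋆ γ = δ₀ applies.
module InversionPrinciple (c γ : ℕ → ℤ) (γ0≡1 : γ 0 ≡ 1ℤ) (c⋆γ≡δ₀ : ∀ p → conv c γ p ≡ δ₀ p) where

  c0≡1 : c 0 ≡ 1ℤ
  c0≡1 = begin
    c 0                ≡⟨ ℤP.*-identityʳ (c 0) ⟨
    c 0 * 1ℤ           ≡⟨ cong (c 0 *_) γ0≡1 ⟨
    c 0 * γ 0          ≡⟨ ℤP.+-identityʳ (c 0 * γ 0) ⟨
    conv c γ 0         ≡⟨ c⋆γ≡δ₀ 0 ⟩
    1ℤ                 ∎
    where open ≡-Reasoning

  conv-suc : ∀ p → conv c γ (suc p) ≡ c (suc p) + sumBelow (suc p) (λ i → c i * γ (suc p ∸ i))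
  conv-suc p = cong (_+ sumBelow (suc p) (λ i → c i * γ (suc p ∸ i)))
    (trans (cong (λ n → c (suc p) * γ n) (ℕP.n∸n≡0 p))
           (trans (cong (c (suc p) *_) γ0≡1) (ℤP.*-identityʳ (c (suc p)))))

  G : Series
  G = runSeries γ

  -- incFrom p x u is the coefficient of incSeries c at v ++ u, for v weakly increasing
  -- of length p ending in x.
  incFrom : ℕ → ℕ → Series
  incFrom p x u = ι (weakInc (x ∷ u)) * c (p ℕ.+ length u)

  ∂-incFrom : ∀ p x b → ∂ b (incFrom p x) ≗ (ι (x ≤ᵇ b) · incFrom (suc p) b)
  ∂-incFrom p x b u = begin
    ι ((x ≤ᵇ b) ∧ weakInc (b ∷ u)) * c (p ℕ.+ suc (length u))
      ≡⟨ cong₂ _*_ (ι-∧ (x ≤ᵇ b) (weakInc (b ∷ u))) (cong c (ℕP.+-suc p (length u))) ⟩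
    ι (x ≤ᵇ b) * ι (weakInc (b ∷ u)) * c (suc p ℕ.+ length u)
      ≡⟨ ℤP.*-assoc (ι (x ≤ᵇ b)) _ _ ⟩
    ι (x ≤ᵇ b) * incFrom (suc p) b u ∎
    where open ≡-Reasoning

  -- The cuts of v ++ w that fall inside the weakly increasing prefix v (of length suc p,
  -- ending in x) after the first i letters contribute c i · runWeight γ (suc p - i) x w.
  cutsInPrefix : ℕ → ℕ → Word → ℤ
  cutsInPrefix p x w = sumBelow (suc p) (λ i → c i * runWeight γ (suc p ∸ i) x w)

  cutsAfterPrefix : ∀ p x b w → (incFrom (suc p) x ⊛ G) (b ∷ w)
                    ≡ c (suc p) * runWeight γ 1 b w + ι (x ≤ᵇ b) * (incFrom (suc (suc p)) b ⊛ G) w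
  cutsAfterPrefix p x b w = begin
    (incFrom (suc p) x ⊛ G) (b ∷ w)
      ≡⟨ ⊛-cons (incFrom (suc p) x) G b w ⟩
    1ℤ * c (suc p ℕ.+ 0) * G (b ∷ w) + (∂ b (incFrom (suc p) x) ⊛ G) w
      ≡⟨ cong₂ (λ y z → y * G (b ∷ w) + z)
               (trans (ℤP.*-identityˡ _) (cong c (ℕP.+-identityʳ (suc p))))
               (⊛-congˡ G (∂-incFrom (suc p) x b) w) ⟩
    c (suc p) * runWeight γ 1 b w + ((ι (x ≤ᵇ b) · incFrom (suc (suc p)) b) ⊛ G) w
      ≡⟨ cong (c (suc p) * runWeight γ 1 b w +_) (⊛-scaleˡ (ι (x ≤ᵇ b)) (incFrom (suc (suc p)) b) G w) ⟩
    c (suc p) * runWeight γ 1 b w + ι (x ≤ᵇ b) * (incFrom (suc (suc p)) b ⊛ G) w ∎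
    where open ≡-Reasoning

  -- If b continues the run of x, the cut just before b moves into the prefix.
  cuts-runContinues : ∀ p x b w → (x ≤ᵇ b) ≡ true →
    cutsInPrefix p x (b ∷ w) + (incFrom (suc p) x ⊛ G) (b ∷ w)
    ≡ cutsInPrefix (suc p) b w + (incFrom (suc (suc p)) b ⊛ G) w
  cuts-runContinues p x b w x≤b = begin
    cutsInPrefix p x (b ∷ w) + (incFrom (suc p) x ⊛ G) (b ∷ w)
      ≡⟨ cong₂ _+_ moveIn (trans (cutsAfterPrefix p x b w) (cong (λ t → c (suc p) * runWeight γ 1 b w + ι t * X) x≤b)) ⟩
    S + (c (suc p) * runWeight γ 1 b w + 1ℤ * X)
      ≡⟨ regroup S (c (suc p) * runWeight γ 1 b w) X ⟩
    (c (suc p) * runWeight γ 1 b w + S) + X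
      ≡⟨ cong (λ n → (c (suc p) * runWeight γ n b w + S) + X) (ℕP.m+n∸n≡m 1 p) ⟨
    cutsInPrefix (suc p) b w + X ∎
    where
    open ≡-Reasoning
    S X : ℤ
    S = sumBelow (suc p) (λ i → c i * runWeight γ (suc (suc p) ∸ i) b w)
    X = (incFrom (suc (suc p)) b ⊛ G) w
    moveIn : cutsInPrefix p x (b ∷ w) ≡ S
    moveIn = sumBelow-cong (suc p) (λ i i<1+p → cong (c i *_)
      (trans (runWeight-asc γ (suc p ∸ i) x b w x≤b)
             (cong (λ n → runWeight γ n b w) (sym (ℕP.+-∸-assoc 1 (ℕP.<⇒≤ i<1+p))))))
    regroup : ∀ s y z → s + (y + 1ℤ * z) ≡ (y + s) + z
    regroup = solve-∀

  -- If b starts a new run, the cuts inside the prefix add up to conv c γ (suc p) = 0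
  -- times the weight of the rest.
  cuts-runBreaks : ∀ p x b w → (x ≤ᵇ b) ≡ false →
    cutsInPrefix p x (b ∷ w) + (incFrom (suc p) x ⊛ G) (b ∷ w) ≡ 0ℤ
  cuts-runBreaks p x b w x≰b = begin
    cutsInPrefix p x (b ∷ w) + (incFrom (suc p) x ⊛ G) (b ∷ w)
      ≡⟨ cong₂ _+_ factorOut (trans (cutsAfterPrefix p x b w) (cong (λ t → c (suc p) * R + ι t * X) x≰b)) ⟩
    S * R + (c (suc p) * R + 0ℤ * X)
      ≡⟨ regroup S (c (suc p)) R X ⟩
    (c (suc p) + S) * R              ≡⟨ cong (_* R) (conv-suc p) ⟨
    conv c γ (suc p) * R             ≡⟨ cong (_* R) (c⋆γ≡δ₀ (suc p)) ⟩
    0ℤ ∎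
    where
    open ≡-Reasoning
    S R X : ℤ
    S = sumBelow (suc p) (λ i → c i * γ (suc p ∸ i))
    R = runWeight γ 1 b w
    X = (incFrom (suc (suc p)) b ⊛ G) w
    factorOut : cutsInPrefix p x (b ∷ w) ≡ S * R
    factorOut = trans (sumBelow-cong (suc p) {g = λ i → c i * γ (suc p ∸ i) * R} (λ i _ →
        trans (cong (c i *_) (runWeight-desc γ (suc p ∸ i) x b w x≰b))
              (sym (ℤP.*-assoc (c i) (γ (suc p ∸ i)) R))))
      (sumOver-scaleʳ R (λ i → c i * γ (suc p ∸ i)) (downFrom (suc p)))
    regroup : ∀ s y r z → s * r + (y * r + 0ℤ * z) ≡ (y + s) * r
    regroup = solve-∀

  cuts-cancel : ∀ w p x → cutsInPrefix p x w + (incFrom (suc p) x ⊛ G) w ≡ 0ℤ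
  cuts-cancel [] p x = begin
    cutsInPrefix p x [] + (incFrom (suc p) x ⊛ G) []
      ≡⟨ cong (cutsInPrefix p x [] +_) atEnd ⟩
    cutsInPrefix p x [] + c (suc p)            ≡⟨ ℤP.+-comm _ (c (suc p)) ⟩
    c (suc p) + cutsInPrefix p x []            ≡⟨ conv-suc p ⟨
    conv c γ (suc p)                           ≡⟨ c⋆γ≡δ₀ (suc p) ⟩
    0ℤ                                         ∎
    where
    open ≡-Reasoning
    atEnd : (incFrom (suc p) x ⊛ G) [] ≡ c (suc p)
    atEnd = trans (⊛-nil (incFrom (suc p) x) G)
      (trans (ℤP.*-identityʳ (1ℤ * c (suc p ℕ.+ 0)))
             (trans (ℤP.*-identityˡ (c (suc p ℕ.+ 0))) (cong c (ℕP.+-identityʳ (suc p)))))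
  cuts-cancel (b ∷ w) p x = byRun (x ≤ᵇ b) refl
    where
    byRun : ∀ t → (x ≤ᵇ b) ≡ t → cutsInPrefix p x (b ∷ w) + (incFrom (suc p) x ⊛ G) (b ∷ w) ≡ 0ℤ
    byRun true x≤b = trans (cuts-runContinues p x b w x≤b) (cuts-cancel w (suc p) b)
    byRun false x≰b = cuts-runBreaks p x b w x≰b

  -- The whole product: the empty prefix of b ∷ w is the cut inside the one-letter run b.
  rightInverse : (incSeries c ⊛ G) ≗ oneS
  rightInverse [] = trans (⊛-nil (incSeries c) G)
    (trans (ℤP.*-identityʳ (1ℤ * c 0)) (trans (ℤP.*-identityˡ (c 0)) c0≡1))
  rightInverse (b ∷ w) = begin
    (incSeries c ⊛ G) (b ∷ w)                   ≡⟨ ⊛-cons (incSeries c) G b w ⟩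
    1ℤ * c 0 * runWeight γ 1 b w + (incFrom 1 b ⊛ G) w
      ≡⟨ cong (λ y → y * runWeight γ 1 b w + (incFrom 1 b ⊛ G) w) (ℤP.*-identityˡ (c 0)) ⟩
    c 0 * runWeight γ 1 b w + (incFrom 1 b ⊛ G) w
      ≡⟨ cong (_+ (incFrom 1 b ⊛ G) w) (ℤP.+-identityʳ (c 0 * runWeight γ 1 b w)) ⟨
    cutsInPrefix 0 b w + (incFrom 1 b ⊛ G) w   ≡⟨ cuts-cancel w 0 b ⟩
    0ℤ ∎
    where open ≡-Reasoning

  incSeries-inverse : IsInverse (incSeries c) G
  incSeries-inverse = rightInverse⇒inverse (incSeries c) G (trans (ℤP.*-identityˡ (c 0)) c0≡1) rightInverse

lastW-irrelevant : ∀ c t d d' → lastW (c ∷ t) d ≡ lastW (c ∷ t) d'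
lastW-irrelevant c [] d d' = refl
lastW-irrelevant c (x ∷ t) d d' = lastW-irrelevant x t d d'

descent-tail : ∀ b c t v → descentBetween (b ∷ c ∷ t) v ≡ descentBetween (c ∷ t) v
descent-tail b c t [] = refl
descent-tail b c t (e ∷ v) = cong (e <ᵇ_) (lastW-irrelevant c t b c)

ribbon-one : ∀ L b c w → ribbonOK (1 ∷ L) (b ∷ c ∷ w) ≡ (c <ᵇ b) ∧ ribbonOK L (c ∷ w)
ribbon-one [] b c w = sym (BoolP.∧-zeroʳ (c <ᵇ b))
ribbon-one (l ∷ L) b c w = refl

ribbon-grow : ∀ a L b c w →
  ribbonOK (suc (suc a) ∷ L) (b ∷ c ∷ w) ≡ (b ≤ᵇ c) ∧ ribbonOK (suc a ∷ L) (c ∷ w)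
ribbon-grow a [] b c w = ∧-swap (length w ≡ᵇ a) (b ≤ᵇ c) (weakInc (c ∷ w))
  where
  ∧-swap : ∀ x y z → x ∧ (y ∧ z) ≡ y ∧ (x ∧ z)
  ∧-swap true y z = refl
  ∧-swap false y z = sym (BoolP.∧-zeroʳ y)
ribbon-grow a (l ∷ L) b c w with b ≤ᵇ c
... | true = cong (λ z → (suc (length (take a w)) ≡ᵇ suc a) ∧ weakInc (c ∷ take a w) ∧ z ∧ ribbonOK (l ∷ L) (drop a w))
                  (descent-tail b c (take a w) (drop a w))
... | false = BoolP.∧-zeroʳ (suc (length (take a w)) ≡ᵇ suc a)

firstPartGrown : (List ℕ → ℤ) → List ℕ → ℤ
firstPartGrown φ [] = 0ℤ
firstPartGrown φ (a ∷ L) = φ (suc a ∷ L)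

sum-compositions-suc : ∀ n (φ : List ℕ → ℤ) → sumOver φ (compositions (suc n))
  ≡ sumOver (λ L → φ (1 ∷ L)) (compositions n) + sumOver (firstPartGrown φ) (compositions n)
sum-compositions-suc n φ =
  trans (sumOver-concatMap φ _ (compositions n))
  (trans (sumOver-cong (λ { [] → refl ; (a ∷ L) → cong (φ (1 ∷ a ∷ L) +_) (ℤP.+-identityʳ (φ (suc a ∷ L))) })
                       (compositions n))
         (sumOver-+ (λ L → φ (1 ∷ L)) (firstPartGrown φ) (compositions n)))

sum-compositions-cong : ∀ n (φ ψ : List ℕ → ℤ) → (∀ a L → φ (suc a ∷ L) ≡ ψ (suc a ∷ L)) →
  sumOver φ (compositions (suc n)) ≡ sumOver ψ (compositions (suc n))
sum-compositions-cong n φ ψ φ≡ψ = begin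
  sumOver φ (compositions (suc n))
    ≡⟨ sum-compositions-suc n φ ⟩
  sumOver (λ L → φ (1 ∷ L)) (compositions n) + sumOver (firstPartGrown φ) (compositions n)
    ≡⟨ cong₂ _+_ (sumOver-cong (φ≡ψ 0) (compositions n)) (sumOver-cong grown (compositions n)) ⟩
  sumOver (λ L → ψ (1 ∷ L)) (compositions n) + sumOver (firstPartGrown ψ) (compositions n)
    ≡⟨ sum-compositions-suc n ψ ⟨
  sumOver ψ (compositions (suc n)) ∎
  where
  open ≡-Reasoning
  grown : firstPartGrown φ ≗ firstPartGrown ψ
  grown [] = refl
  grown (a ∷ L) = φ≡ψ a L

-- Ribbon sums: for any set P of allowed parts, Σ_{L : all parts in P} r_L is the run series
-- of the indicator of P, because each word has exactly one ribbon shape.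
module RibbonSum (P : ℕ → Bool) where

  γ : ℕ → ℤ
  γ q = ι (P q)

  -- The first part of the ribbon continues a run of s letters already read.
  shiftFirst : ℕ → List ℕ → List ℕ
  shiftFirst s [] = []
  shiftFirst s (a ∷ L) = a ℕ.+ s ∷ L

  shiftFirst-zero : ∀ L → shiftFirst 0 L ≡ L
  shiftFirst-zero [] = refl
  shiftFirst-zero (a ∷ L) = cong (_∷ L) (ℕP.+-identityʳ a)

  -- partialSum s w is Σ_{L ⊨ P} r_L at v ++ w, for v weakly increasing of length s whose
  -- last letter does not exceed the first letter of w (so v's run continues into w).
  term : ℕ → Word → List ℕ → ℤ
  term s w L = ι (all P (shiftFirst s L)) * ι (ribbonOK L w)

  partialSum : ℕ → Word → ℤ
  partialSum s w = sumOver (term s w) (compositions (length w))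

  term-one : ∀ s b c w L → term s (b ∷ c ∷ w) (1 ∷ L) ≡ ι (c <ᵇ b) * γ (suc s) * term 0 (c ∷ w) L
  term-one s b c w L = begin
    ι (P (suc s) ∧ all P L) * ι (ribbonOK (1 ∷ L) (b ∷ c ∷ w))
      ≡⟨ cong₂ _*_ (ι-∧ (P (suc s)) (all P L)) (trans (cong ι (ribbon-one L b c w)) (ι-∧ (c <ᵇ b) _)) ⟩
    γ (suc s) * ι (all P L) * (ι (c <ᵇ b) * ι (ribbonOK L (c ∷ w)))
      ≡⟨ reorder (γ (suc s)) (ι (all P L)) (ι (c <ᵇ b)) (ι (ribbonOK L (c ∷ w))) ⟩
    ι (c <ᵇ b) * γ (suc s) * (ι (all P L) * ι (ribbonOK L (c ∷ w)))
      ≡⟨ cong (λ K → ι (c <ᵇ b) * γ (suc s) * (ι (all P K) * ι (ribbonOK L (c ∷ w)))) (shiftFirst-zero L) ⟨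
    ι (c <ᵇ b) * γ (suc s) * term 0 (c ∷ w) L ∎
    where
    open ≡-Reasoning
    reorder : ∀ g a d x → g * a * (d * x) ≡ d * g * (a * x)
    reorder = solve-∀

  term-grow : ∀ s b c w a L →
    firstPartGrown (term s (b ∷ c ∷ w)) (suc a ∷ L) ≡ ι (b ≤ᵇ c) * term (suc s) (c ∷ w) (suc a ∷ L)
  term-grow s b c w a L = begin
    ι (all P (suc (suc a) ℕ.+ s ∷ L)) * ι (ribbonOK (suc (suc a) ∷ L) (b ∷ c ∷ w))
      ≡⟨ cong₂ (λ n t → ι (all P (n ∷ L)) * ι t) (sym (cong suc (ℕP.+-suc a s))) (ribbon-grow a L b c w) ⟩
    A * ι ((b ≤ᵇ c) ∧ ribbonOK (suc a ∷ L) (c ∷ w))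
      ≡⟨ cong (A *_) (ι-∧ (b ≤ᵇ c) (ribbonOK (suc a ∷ L) (c ∷ w))) ⟩
    A * (ι (b ≤ᵇ c) * ι (ribbonOK (suc a ∷ L) (c ∷ w)))
      ≡⟨ reorder A (ι (b ≤ᵇ c)) (ι (ribbonOK (suc a ∷ L) (c ∷ w))) ⟩
    ι (b ≤ᵇ c) * term (suc s) (c ∷ w) (suc a ∷ L) ∎
    where
    open ≡-Reasoning
    A : ℤ
    A = ι (all P (suc a ℕ.+ suc s ∷ L))
    reorder : ∀ x y z → x * (y * z) ≡ y * (x * z)
    reorder = solve-∀

  partialSum-cons : ∀ s b w → partialSum s (b ∷ w) ≡ runWeight γ (suc s) b w
  partialSum-cons s b [] = trans (ℤP.+-identityʳ _)
    (trans (ℤP.*-identityʳ _) (cong ι (BoolP.∧-identityʳ (P (suc s)))))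
  partialSum-cons s b (c ∷ w) = begin
    partialSum s (b ∷ c ∷ w)
      ≡⟨ sum-compositions-suc (suc (length w)) (term s (b ∷ c ∷ w)) ⟩
    sumOver (λ L → term s (b ∷ c ∷ w) (1 ∷ L)) Cs + sumOver (firstPartGrown (term s (b ∷ c ∷ w))) Cs
      ≡⟨ cong₂ _+_ (trans (sumOver-cong (term-one s b c w) Cs) (sumOver-scale (ι (c <ᵇ b) * γ (suc s)) _ Cs))
                   (trans (sum-compositions-cong (length w) _ _ (term-grow s b c w))
                          (sumOver-scale (ι (b ≤ᵇ c)) _ Cs)) ⟩
    ι (c <ᵇ b) * γ (suc s) * partialSum 0 (c ∷ w) + ι (b ≤ᵇ c) * partialSum (suc s) (c ∷ w)
      ≡⟨ cong₂ (λ x y → ι (c <ᵇ b) * γ (suc s) * x + ι (b ≤ᵇ c) * y)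
               (partialSum-cons 0 c w) (partialSum-cons (suc s) c w) ⟩
    ι (c <ᵇ b) * γ (suc s) * runWeight γ 1 c w + ι (b ≤ᵇ c) * runWeight γ (suc (suc s)) c w
      ≡⟨ runWeight-cons γ (suc s) b c w ⟨
    runWeight γ (suc s) b (c ∷ w) ∎
    where
    open ≡-Reasoning
    Cs : List (List ℕ)
    Cs = compositions (suc (length w))

  ribbonSum : ∀ w → sumOver (λ L → ι (all P L) * ι (ribbonOK L w)) (compositions (length w)) ≡ runSeries γ w
  ribbonSum [] = refl
  ribbonSum (b ∷ w) = trans (sumOver-cong (λ L → cong (λ K → ι (all P K) * ι (ribbonOK L (b ∷ w))) (sym (shiftFirst-zero L)))
                                          (compositions (suc (length w))))
                            (partialSum-cons 0 b w)

module Arithmetic (m' r' : ℕ) where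

  m r : ℕ
  m = suc m'
  r = suc r'

  γ : ℕ → ℤ
  γ q = ι (goodPart m r q)

  γ-periodic : ∀ q → γ (q ℕ.+ m ℕ.* r) ≡ γ q
  γ-periodic q = cong (λ n → ι (n <ᵇ r)) ([m+n]%n≡m%n q (m ℕ.* r))

  γ-small : ∀ q → q < m ℕ.* r → γ q ≡ ι (q <ᵇ r)
  γ-small q q<mr = cong (λ n → ι (n <ᵇ r)) (m<n⇒m%n≡m q<mr)

  -- c n is the coefficient of h_n in Σ_{k<m} (h_{kr} - h_{kr+1}).
  c : ℕ → ℤ
  c n = sumBelow m (λ k → ι (n ≡ᵇ k ℕ.* r) - ι (n ≡ᵇ suc (k ℕ.* r)))

  LHS-inc : LHSseries m r ≗ incSeries c
  LHS-inc u = begin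
    LHSseries m r u
      ≡⟨ ΣS-coeff m (λ k → h (k ℕ.* r) ⊖ h (suc (k ℕ.* r))) u ⟩
    sumBelow m (λ k → (h (k ℕ.* r) ⊖ h (suc (k ℕ.* r))) u)
      ≡⟨ sumBelow-cong m (λ k _ → trans
           (cong₂ _-_ (ι-∧ (length u ≡ᵇ k ℕ.* r) W) (ι-∧ (length u ≡ᵇ suc (k ℕ.* r)) W))
           (factor (ι (length u ≡ᵇ k ℕ.* r)) (ι (length u ≡ᵇ suc (k ℕ.* r))) (ι W))) ⟩
    sumBelow m (λ k → ι W * (ι (length u ≡ᵇ k ℕ.* r) - ι (length u ≡ᵇ suc (k ℕ.* r))))
      ≡⟨ sumOver-scale (ι W) _ (downFrom m) ⟩
    incSeries c u ∎
    where
    open ≡-Reasoning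
    W : Bool
    W = weakInc u
    factor : ∀ a b x → a * x - b * x ≡ x * (a - b)
    factor = solve-∀

  -- E p = Σ_{k<m, kr ≤ p} γ (p - kr).  Exactly one such k has p - kr ≡ 0, …, r-1 mod mr.
  E : ℕ → ℤ
  E p = sumBelow m (λ k → ι (k ℕ.* r <ᵇ suc p) * γ (p ∸ k ℕ.* r))

  -- The same sum shifted by one; it is E (p - 1) for p ≥ 1 and vanishes for p = 0.
  E′ : ℕ → ℤ
  E′ p = sumBelow m (λ k → ι (suc (k ℕ.* r) <ᵇ suc p) * γ (p ∸ suc (k ℕ.* r)))

  -- Expanding c as a sum of Kronecker deltas and summing them out.
  conv≡E-E′ : ∀ p → conv c γ p ≡ E p - E′ p
  conv≡E-E′ p = begin
    sumBelow (suc p) (λ i → c i * g i)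
      ≡⟨ sumBelow-cong (suc p) (λ i _ → sym (sumOver-scaleʳ (g i) (λ k → d₁ i k - d₂ i k) (downFrom m))) ⟩
    sumBelow (suc p) (λ i → sumBelow m (λ k → (d₁ i k - d₂ i k) * g i))
      ≡⟨ sumOver-swap (λ i k → (d₁ i k - d₂ i k) * g i) (downFrom (suc p)) (downFrom m) ⟩
    sumBelow m (λ k → sumBelow (suc p) (λ i → (d₁ i k - d₂ i k) * g i))
      ≡⟨ sumBelow-cong m (λ k _ → deltas k) ⟩
    sumBelow m (λ k → ι (k ℕ.* r <ᵇ suc p) * g (k ℕ.* r) - ι (suc (k ℕ.* r) <ᵇ suc p) * g (suc (k ℕ.* r)))
      ≡⟨ sumOver-- (λ k → ι (k ℕ.* r <ᵇ suc p) * g (k ℕ.* r))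
                   (λ k → ι (suc (k ℕ.* r) <ᵇ suc p) * g (suc (k ℕ.* r))) (downFrom m) ⟩
    E p - E′ p ∎
    where
    open ≡-Reasoning
    g : ℕ → ℤ
    g i = γ (p ∸ i)
    d₁ d₂ : ℕ → ℕ → ℤ
    d₁ i k = ι (i ≡ᵇ k ℕ.* r)
    d₂ i k = ι (i ≡ᵇ suc (k ℕ.* r))
    distrib : ∀ a b x → (a - b) * x ≡ a * x - b * x
    distrib = solve-∀
    deltas : ∀ k → sumBelow (suc p) (λ i → (d₁ i k - d₂ i k) * g i)
                   ≡ ι (k ℕ.* r <ᵇ suc p) * g (k ℕ.* r) - ι (suc (k ℕ.* r) <ᵇ suc p) * g (suc (k ℕ.* r))
    deltas k = trans (sumBelow-cong (suc p) (λ i _ → distrib (d₁ i k) (d₂ i k) (g i)))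
      (trans (sumOver-- (λ i → d₁ i k * g i) (λ i → d₂ i k * g i) (downFrom (suc p)))
             (cong₂ _-_ (sumBelow-delta (suc p) (k ℕ.* r) g) (sumBelow-delta (suc p) (suc (k ℕ.* r)) g)))

  E′-zero : E′ 0 ≡ 0ℤ
  E′-zero = sumOver-zero (downFrom m)

  -- Increasing p by r shifts the index k by one; the term falling off the top comes back
  -- at the bottom because γ has period mr.
  wrapAround : ∀ p → γ (p ℕ.+ r) ≡ ι (m' ℕ.* r <ᵇ suc p) * γ (p ∸ m' ℕ.* r)
  wrapAround p with m' ℕ.* r ℕ.≤? p
  ... | yes m'r≤p = begin
    γ (p ℕ.+ r)                           ≡⟨ cong γ p+r≡ ⟩
    γ (p ∸ m' ℕ.* r ℕ.+ m ℕ.* r)          ≡⟨ γ-periodic (p ∸ m' ℕ.* r) ⟩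
    γ (p ∸ m' ℕ.* r)                      ≡⟨ ℤP.*-identityˡ _ ⟨
    1ℤ * γ (p ∸ m' ℕ.* r)                 ≡⟨ cong (λ t → ι t * γ (p ∸ m' ℕ.* r)) (<ᵇ-true (s≤s m'r≤p)) ⟨
    ι (m' ℕ.* r <ᵇ suc p) * γ (p ∸ m' ℕ.* r) ∎
    where
    open ≡-Reasoning
    p+r≡ : p ℕ.+ r ≡ p ∸ m' ℕ.* r ℕ.+ m ℕ.* r
    p+r≡ = begin
      p ℕ.+ r                                 ≡⟨ cong (ℕ._+ r) (ℕP.m∸n+n≡m m'r≤p) ⟨
      p ∸ m' ℕ.* r ℕ.+ m' ℕ.* r ℕ.+ r         ≡⟨ ℕP.+-assoc (p ∸ m' ℕ.* r) (m' ℕ.* r) r ⟩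
      p ∸ m' ℕ.* r ℕ.+ (m' ℕ.* r ℕ.+ r)       ≡⟨ cong (p ∸ m' ℕ.* r ℕ.+_) (ℕP.+-comm (m' ℕ.* r) r) ⟩
      p ∸ m' ℕ.* r ℕ.+ m ℕ.* r                ∎
  ... | no m'r≰p = begin
    γ (p ℕ.+ r)                   ≡⟨ γ-small (p ℕ.+ r) p+r<mr ⟩
    ι (p ℕ.+ r <ᵇ r)              ≡⟨ cong ι (<ᵇ-false (ℕP.m≤n+m r p)) ⟩
    0ℤ                            ≡⟨ cong (λ t → ι t * γ (p ∸ m' ℕ.* r)) (<ᵇ-false (ℕP.≰⇒> m'r≰p)) ⟨
    ι (m' ℕ.* r <ᵇ suc p) * γ (p ∸ m' ℕ.* r) ∎
    where
    open ≡-Reasoning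
    p+r<mr : p ℕ.+ r < m ℕ.* r
    p+r<mr = subst (p ℕ.+ r <_) (ℕP.+-comm (m' ℕ.* r) r) (ℕP.+-monoˡ-< r (ℕP.≰⇒> m'r≰p))

  E-shift : ∀ p → E (p ℕ.+ r) ≡ E p
  E-shift p = begin
    E (p ℕ.+ r)
      ≡⟨ sumBelow-first m' (λ k → ι (k ℕ.* r <ᵇ suc (p ℕ.+ r)) * γ (p ℕ.+ r ∸ k ℕ.* r)) ⟩
    1ℤ * γ (p ℕ.+ r) + sumBelow m' (λ k → ι (r ℕ.+ k ℕ.* r <ᵇ suc (p ℕ.+ r)) * γ (p ℕ.+ r ∸ (r ℕ.+ k ℕ.* r)))
      ≡⟨ cong₂ _+_ (trans (ℤP.*-identityˡ _) (wrapAround p)) (sumBelow-cong m' (λ k _ → shifted k)) ⟩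
    E p ∎
    where
    open ≡-Reasoning
    p+r≡r+p : p ℕ.+ r ≡ r ℕ.+ p
    p+r≡r+p = ℕP.+-comm p r
    shifted : ∀ k → ι (r ℕ.+ k ℕ.* r <ᵇ suc (p ℕ.+ r)) * γ (p ℕ.+ r ∸ (r ℕ.+ k ℕ.* r))
                    ≡ ι (k ℕ.* r <ᵇ suc p) * γ (p ∸ k ℕ.* r)
    shifted k = cong₂ (λ t n → ι t * γ n)
      (trans (cong (λ n → r ℕ.+ k ℕ.* r <ᵇ suc n) p+r≡r+p)
             (trans (cong (r ℕ.+ k ℕ.* r <ᵇ_) (sym (ℕP.+-suc r p))) (<ᵇ-cancelˡ r (k ℕ.* r) (suc p))))
      (trans (cong (_∸ (r ℕ.+ k ℕ.* r)) p+r≡r+p) (ℕP.[m+n]∸[m+o]≡n∸o r p (k ℕ.* r)))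

  E-small : ∀ p → p < r → E p ≡ 1ℤ
  E-small p p<r = begin
    E p
      ≡⟨ sumBelow-first m' (λ k → ι (k ℕ.* r <ᵇ suc p) * γ (p ∸ k ℕ.* r)) ⟩
    1ℤ * γ p + sumBelow m' (λ k → ι (r ℕ.+ k ℕ.* r <ᵇ suc p) * γ (p ∸ (r ℕ.+ k ℕ.* r)))
      ≡⟨ cong₂ _+_ (trans (ℤP.*-identityˡ (γ p)) γp≡1) tooLate ⟩
    1ℤ + 0ℤ ∎
    where
    open ≡-Reasoning
    γp≡1 : γ p ≡ 1ℤ
    γp≡1 = trans (γ-small p (ℕP.<-≤-trans p<r (ℕP.m≤n*m r m))) (cong ι (<ᵇ-true p<r))
    tooLate : sumBelow m' (λ k → ι (r ℕ.+ k ℕ.* r <ᵇ suc p) * γ (p ∸ (r ℕ.+ k ℕ.* r))) ≡ 0ℤ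
    tooLate = trans (sumBelow-cong m' (λ k _ →
        cong (λ t → ι t * γ (p ∸ (r ℕ.+ k ℕ.* r))) (<ᵇ-false (ℕP.≤-trans p<r (ℕP.m≤m+n r (k ℕ.* r))))))
      (sumOver-zero (downFrom m'))

  E-periodic : ∀ s k → E (s ℕ.+ k ℕ.* r) ≡ E s
  E-periodic s zero = cong E (ℕP.+-identityʳ s)
  E-periodic s (suc k) = begin
    E (s ℕ.+ (r ℕ.+ k ℕ.* r))     ≡⟨ cong E (sym (ℕP.+-assoc s r (k ℕ.* r))) ⟩
    E (s ℕ.+ r ℕ.+ k ℕ.* r)       ≡⟨ cong (λ n → E (n ℕ.+ k ℕ.* r)) (ℕP.+-comm s r) ⟩
    E (r ℕ.+ s ℕ.+ k ℕ.* r)       ≡⟨ cong E (ℕP.+-assoc r s (k ℕ.* r)) ⟩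
    E (r ℕ.+ (s ℕ.+ k ℕ.* r))     ≡⟨ cong E (ℕP.+-comm r (s ℕ.+ k ℕ.* r)) ⟩
    E (s ℕ.+ k ℕ.* r ℕ.+ r)       ≡⟨ E-shift (s ℕ.+ k ℕ.* r) ⟩
    E (s ℕ.+ k ℕ.* r)             ≡⟨ E-periodic s k ⟩
    E s                           ∎
    where open ≡-Reasoning

  E≡1 : ∀ p → E p ≡ 1ℤ
  E≡1 p = begin
    E p                           ≡⟨ cong E (m≡m%n+[m/n]*n p r) ⟩
    E (p % r ℕ.+ (p / r) ℕ.* r)   ≡⟨ E-periodic (p % r) (p / r) ⟩
    E (p % r)                     ≡⟨ E-small (p % r) (m%n<n p r) ⟩
    1ℤ                            ∎
    where open ≡-Reasoning

  c⋆γ≡δ₀ : ∀ p → conv c γ p ≡ δ₀ p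
  c⋆γ≡δ₀ zero = trans (conv≡E-E′ 0) (cong₂ _-_ (E≡1 0) E′-zero)
  c⋆γ≡δ₀ (suc p) = trans (conv≡E-E′ (suc p)) (cong₂ _-_ (E≡1 (suc p)) (E≡1 p))

  goodComp≡all : ∀ L → goodComp m r L ≡ all (goodPart m r) L
  goodComp≡all [] = refl
  goodComp≡all (q ∷ L) = cong (goodPart m r q ∧_) (goodComp≡all L)

  RHS-run : RHSseries m r ≗ runSeries γ
  RHS-run w = begin
    RHSseries m r w
      ≡⟨ sumOver-filter (goodComp m r) (λ L → ribbon L w) (compositions (length w)) ⟩
    sumOver (λ L → ι (goodComp m r L) * ι (ribbonOK L w)) (compositions (length w))
      ≡⟨ sumOver-cong (λ L → cong (λ t → ι t * ι (ribbonOK L w)) (goodComp≡all L)) (compositions (length w)) ⟩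
    sumOver (λ L → ι (all (goodPart m r) L) * ι (ribbonOK L w)) (compositions (length w))
      ≡⟨ RibbonSum.ribbonSum (goodPart m r) w ⟩
    runSeries γ w ∎
    where open ≡-Reasoning

proposition3 : (m r : ℕ) → .{{_ : NonZero m}} → .{{_ : NonZero r}} →
    IsInverse (LHSseries m r) (RHSseries m r)
proposition3 (suc m') (suc r') =
  IsInverse-cong LHS-inc RHS-run (InversionPrinciple.incSeries-inverse c γ refl c⋆γ≡δ₀)
  where open Arithmetic m' r'
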